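{- Let $p$ be an odd prime and let $q\in\mathbb{C}_p$ with $|1-q|_p<1$. For every $n\in\mathbb{N}=\{1,2,3,\dots\}$, $$q\,E_{n,q}(2)=2+\frac{1}{q}E_{n,q}.$$
   Context: $\mathbb{C}_p$ denotes the completion of an algebraic closure of $\mathbb{Q}_p$. For $q\in\mathbb{C}_p$ with $|1-q|_p<1$, the $q$-Euler numbers $E_{n,q}$ and $q$-Euler polynomials $E_{n,q}(x)$ are defined by the generating functions (formal power series in $t$) $$\frac{2}{qe^t+1}=\sum_{n=0}^{\infty}E_{n,q}\frac{t^n}{n!},\qquad \frac{2}{qe^t+1}e^{xt}=\sum_{n=0}^{\infty}E_{n,q}(x)\frac{t^n}{n!},$$ so that $E_{n,q}(x)=\sum_{l=0}^{n}\binom{n}{l}x^{n-l}E_{l,q}$. -}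

module Defs where

open import Level using (Level)
open import Algebra.Bundles using (CommutativeRing)
open import Data.Nat as ℕ using (ℕ; zero; suc)
open import Data.Nat.Combinatorics using (_C_)
open import Data.Fin using (Fin; toℕ; fromℕ)
open import Data.Vec using (Vec; []; _∷ʳ_; lookup)

-- The generating function 2/(q e^t + 1) = Σ E_{n,q} t^n/n! is equivalent
-- (comparing coefficients of t^n/n! in (q e^t + 1) · Σ E_{n,q} t^n/n! = 2) to
--   q Σ_{l=0}^{n} C(n,l) E_{l,q} + E_{n,q} = 2 δ_{n,0},
-- i.e. E_{n,q} = (1+q)^{-1} (2 δ_{n,0} - q Σ_{l<n} C(n,l) E_{l,q}).
-- `u` is the inverse of (q + 1).
module EulerDefs {c ℓ : Level} (R : CommutativeRing c ℓ) where
  open CommutativeRing R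

  _·_ : ℕ → Carrier → Carrier
  zero · x = 0#
  suc n · x = x + n · x

  two : Carrier
  two = 1# + 1#

  pow : Carrier → ℕ → Carrier
  pow x zero = 1#
  pow x (suc n) = x * pow x n

  sumFin : (n : ℕ) → (Fin n → Carrier) → Carrier
  sumFin zero f = 0#
  sumFin (suc n) f = f Fin.zero + sumFin n (λ i → f (Fin.suc i))

  δ₀ : ℕ → Carrier
  δ₀ zero = two
  δ₀ (suc n) = 0#

  -- first n q-Euler numbers E_{0,q}, …, E_{n-1,q}
  table : (q u : Carrier) → (n : ℕ) → Vec Carrier n
  table q u zero = []
  table q u (suc n) =
    let v = table q u n in
    v ∷ʳ (u * (δ₀ n - q * sumFin n (λ i → (n C toℕ i) · lookup v i)))

  Eul : (q u : Carrier) → ℕ → Carrier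
  Eul q u n = lookup (table q u (suc n)) (fromℕ n)

  EulPoly : (q u : Carrier) → ℕ → Carrier → Carrier
  EulPoly q u n x =
    sumFin (suc n) (λ l → (n C toℕ l) · (pow x (n ℕ.∸ toℕ l) * Eul q u (toℕ l)))

module Submission where

-- For a sequence a in a commutative ring let A_n(a; y) = Σ_{l≤n} C(n,l) y^{n-l} a_l
-- be its Appell polynomials, so that E_{n,q}(y) = A_n(E; y) for E = (E_{l,q}).
--   * Pascal's rule gives A_{n+1}(a; y) = y A_n(a; y) + A_n(a ∘ suc; y), and by
--     induction the translation formula A_n(A(a; x); 1) = A_n(a; 1 + x),
--     i.e. E_{n,q}(x + 1) = Σ_k C(n,k) E_{k,q}(x).
--   * The definition of the q-Euler numbers says q E_{k,q}(1) + E_{k,q} = 2 δ_{k,0}.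
--   * Applying A(-; 1) to this recurrence and translating with x = 1 gives
--     q E_{n,q}(2) + E_{n,q}(1) = 2, while for n ≥ 1 the recurrence itself reads
--     E_{n,q}(1) = -q⁻¹ E_{n,q}; eliminating E_{n,q}(1) yields the theorem.

open import Defs
open import Level using (Level)
open import Algebra.Bundles using (CommutativeRing)
open import Data.Nat using (ℕ; zero; suc; _≤_; _<_; _∸_; s≤s)
open import Data.Nat.Properties using (+-∸-assoc; n<1+n; n∸n≡0)
open import Data.Nat.Combinatorics using (_C_; nCn≡1; nCk+nC[k+1]≡[n+1]C[k+1]; k>n⇒nCk≡0)
open import Data.Fin using (Fin; zero; suc; toℕ; fromℕ; inject₁)
open import Data.Fin.Properties using (toℕ<n; toℕ-fromℕ; toℕ-inject₁)
open import Data.Product using (Σ-syntax; _,_)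
open import Data.Sum using (_⊎_; inj₁; inj₂)
open import Data.Vec using (Vec; []; _∷_; _∷ʳ_; lookup)
open import Data.Vec.Functional using (replicate)
open import Relation.Binary.PropositionalEquality as ≡ using (_≡_)
import Relation.Binary.Reasoning.Setoid as SetoidReasoning

module _ {a} {A : Set a} where

  lookup-∷ʳ-last : ∀ {n} (v : Vec A n) x → lookup (v ∷ʳ x) (fromℕ n) ≡ x
  lookup-∷ʳ-last []      x = ≡.refl
  lookup-∷ʳ-last (y ∷ v) x = lookup-∷ʳ-last v x

  lookup-∷ʳ-inject₁ : ∀ {n} (v : Vec A n) x (i : Fin n) →
                      lookup (v ∷ʳ x) (inject₁ i) ≡ lookup v i
  lookup-∷ʳ-inject₁ (y ∷ v) x zero    = ≡.refl
  lookup-∷ʳ-inject₁ (y ∷ v) x (suc i) = lookup-∷ʳ-inject₁ v x i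

last-or-inject₁ : ∀ {n} (i : Fin (suc n)) → i ≡ fromℕ n ⊎ Σ[ j ∈ Fin n ] i ≡ inject₁ j
last-or-inject₁ {zero}  zero    = inj₁ ≡.refl
last-or-inject₁ {suc n} zero    = inj₂ (zero , ≡.refl)
last-or-inject₁ {suc n} (suc i) with last-or-inject₁ i
... | inj₁ ≡.refl       = inj₁ ≡.refl
... | inj₂ (j , ≡.refl) = inj₂ (suc j , ≡.refl)

module AppellPolynomials {c ℓ : Level} (R : CommutativeRing c ℓ) where
  open CommutativeRing R hiding (zero)
  open EulerDefs R
  open import Algebra.Properties.Semiring.Sum semiring
    using (sum; sum-cong-≋; sum-cong-≗; sum-replicate; sum-replicate-zero; ∑-distrib-+; *-distribˡ-sum)
  open import Algebra.Properties.Semiring.Mult semiring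
    using (_×_; ×-cong; ×-congʳ; ×-congˡ; ×-homo-1; ×-homo-+; ×-comm-*)
  open import Algebra.Properties.CommutativeMonoid.Mult +-commutativeMonoid
    using (×-distrib-+)
  open import Algebra.Properties.CommutativeSemigroup +-commutativeSemigroup
    using (x∙yz≈y∙xz; x∙yz≈xz∙y)
  open import Algebra.Properties.CommutativeSemigroup *-commutativeSemigroup
    using () renaming (x∙yz≈y∙xz to x*yz≈y*xz)
  open SetoidReasoning setoid

  ·≡× : ∀ k x → k · x ≡ k × x
  ·≡× zero    x = ≡.refl
  ·≡× (suc k) x = ≡.cong (x +_) (·≡× k x)

  sumFin≡sum : ∀ n (f : Fin n → Carrier) → sumFin n f ≡ sum f
  sumFin≡sum zero    f = ≡.refl
  sumFin≡sum (suc n) f = ≡.cong (f zero +_) (sumFin≡sum n (λ i → f (suc i)))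

  sumFin-· : ∀ n (k : Fin n → ℕ) (f : Fin n → Carrier) →
             sumFin n (λ i → k i · f i) ≡ sum (λ i → k i × f i)
  sumFin-· n k f = ≡.trans (sumFin≡sum n (λ i → k i · f i)) (sum-cong-≗ (λ i → ·≡× (k i) (f i)))

  pow-1# : ∀ k → pow 1# k ≈ 1#
  pow-1# zero    = refl
  pow-1# (suc k) = trans (*-identityˡ _) (pow-1# k)

  ∑< : ℕ → (ℕ → Carrier) → Carrier
  ∑< n f = sum {n} (λ i → f (toℕ i))

  ∑<-cong : ∀ n {f g : ℕ → Carrier} → (∀ l → l < n → f l ≈ g l) → ∑< n f ≈ ∑< n g
  ∑<-cong n f≈g = sum-cong-≋ (λ i → f≈g (toℕ i) (toℕ<n i))

  ∑<-+ : ∀ n (f g : ℕ → Carrier) → ∑< n (λ l → f l + g l) ≈ ∑< n f + ∑< n g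
  ∑<-+ n f g = ∑-distrib-+ {n} (λ i → f (toℕ i)) (λ i → g (toℕ i))

  *-distribˡ-∑< : ∀ n x (f : ℕ → Carrier) → x * ∑< n f ≈ ∑< n (λ l → x * f l)
  *-distribˡ-∑< n x f = *-distribˡ-sum {n} x (λ i → f (toℕ i))

  ∑<-last : ∀ n (f : ℕ → Carrier) → ∑< (suc n) f ≈ ∑< n f + f n
  ∑<-last zero    f = trans (+-identityʳ (f 0)) (sym (+-identityˡ (f 0)))
  ∑<-last (suc n) f = trans (+-congˡ (∑<-last n (λ l → f (suc l)))) (sym (+-assoc _ _ _))

  ∑<-binomial-extend : ∀ n (g : ℕ → Carrier) →
    ∑< (suc (suc n)) (λ l → (n C l) × g l) ≈ ∑< (suc n) (λ l → (n C l) × g l)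
  ∑<-binomial-extend n g = begin
    ∑< (suc (suc n)) (λ l → (n C l) × g l)          ≈⟨ ∑<-last (suc n) (λ l → (n C l) × g l) ⟩
    ∑< (suc n) (λ l → (n C l) × g l) + (n C suc n) × g (suc n)
      ≈⟨ +-congˡ (×-congˡ (k>n⇒nCk≡0 (n<1+n n))) ⟩
    ∑< (suc n) (λ l → (n C l) × g l) + 0#           ≈⟨ +-identityʳ _ ⟩
    ∑< (suc n) (λ l → (n C l) × g l)                ∎

  ∑<-pascal : ∀ n (g : ℕ → Carrier) →
    ∑< (suc (suc n)) (λ l → (suc n C l) × g l) ≈
    ∑< (suc n) (λ l → (n C l) × g l) + ∑< (suc n) (λ l → (n C l) × g (suc l))
  ∑<-pascal n g = begin
    g₀ + ∑< (suc n) (λ l → (suc n C suc l) × g (suc l))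
      ≈⟨ +-congˡ (∑<-cong (suc n) (λ l _ → split l)) ⟩
    g₀ + ∑< (suc n) (λ l → (n C l) × g (suc l) + (n C suc l) × g (suc l))
      ≈⟨ +-congˡ (∑<-+ (suc n) (λ l → (n C l) × g (suc l)) (λ l → (n C suc l) × g (suc l))) ⟩
    g₀ + (shifted + rest)                            ≈⟨ x∙yz≈xz∙y _ _ _ ⟩
    (g₀ + rest) + shifted                            ≈⟨ +-congʳ (∑<-binomial-extend n g) ⟩
    ∑< (suc n) (λ l → (n C l) × g l) + shifted       ∎
    where
    g₀ shifted rest : Carrier
    g₀ = 1 × g 0
    shifted = ∑< (suc n) (λ l → (n C l) × g (suc l))
    rest = ∑< (suc n) (λ l → (n C suc l) × g (suc l))
    split : ∀ l → (suc n C suc l) × g (suc l) ≈ (n C l) × g (suc l) + (n C suc l) × g (suc l)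
    split l = trans (×-congˡ (≡.sym (nCk+nC[k+1]≡[n+1]C[k+1] n l)))
                    (×-homo-+ (g (suc l)) (n C l) (n C suc l))

  appell-term : Carrier → (ℕ → Carrier) → ℕ → ℕ → Carrier
  appell-term y a n l = (n C l) × (pow y (n ∸ l) * a l)

  appell : Carrier → (ℕ → Carrier) → ℕ → Carrier
  appell y a n = ∑< (suc n) (appell-term y a n)

  appell-zero : ∀ y a → appell y a 0 ≈ a 0
  appell-zero y a = trans (+-identityʳ _) (trans (×-homo-1 _) (*-identityˡ (a 0)))

  appell-suc : ∀ y a n → appell y a (suc n) ≈ y * appell y a n + appell y (λ l → a (suc l)) n
  appell-suc y a n = begin
    appell y a (suc n)
      ≈⟨ ∑<-pascal n (λ l → pow y (suc n ∸ l) * a l) ⟩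
    ∑< (suc n) (λ l → (n C l) × (pow y (suc n ∸ l) * a l)) + shifted
      ≈⟨ +-congʳ (∑<-cong (suc n) pull-y) ⟩
    ∑< (suc n) (λ l → y * ((n C l) × (pow y (n ∸ l) * a l))) + shifted
      ≈⟨ +-congʳ (sym (*-distribˡ-∑< (suc n) y (appell-term y a n))) ⟩
    y * appell y a n + shifted                                        ∎
    where
    shifted : Carrier
    shifted = appell y (λ l → a (suc l)) n
    pull-y : ∀ l → l < suc n →
             (n C l) × (pow y (suc n ∸ l) * a l) ≈ y * ((n C l) × (pow y (n ∸ l) * a l))
    pull-y l (s≤s l≤n) = begin
      (n C l) × (pow y (suc n ∸ l) * a l)
        ≈⟨ ×-congʳ (n C l) (reflexive (≡.cong (λ k → pow y k * a l) (+-∸-assoc 1 l≤n))) ⟩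
      (n C l) × ((y * pow y (n ∸ l)) * a l)   ≈⟨ ×-congʳ (n C l) (*-assoc _ _ _) ⟩
      (n C l) × (y * (pow y (n ∸ l) * a l))   ≈⟨ ×-comm-* (n C l) y _ ⟨
      y * ((n C l) × (pow y (n ∸ l) * a l))   ∎

  appell-top : ∀ y a n → appell y a n ≈ ∑< n (appell-term y a n) + a n
  appell-top y a n = trans (∑<-last n (appell-term y a n)) (+-congˡ top)
    where
    top : (n C n) × (pow y (n ∸ n) * a n) ≈ a n
    top = begin
      (n C n) × (pow y (n ∸ n) * a n)
        ≈⟨ ×-cong (nCn≡1 n) (reflexive (≡.cong (λ k → pow y k * a n) (n∸n≡0 n))) ⟩
      1 × (1# * a n)                     ≈⟨ ×-homo-1 _ ⟩
      1# * a n                           ≈⟨ *-identityˡ (a n) ⟩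
      a n                                ∎

  appell-cong : ∀ y {a b} → (∀ l → a l ≈ b l) → ∀ n → appell y a n ≈ appell y b n
  appell-cong y {a} {b} a≈b n =
    ∑<-cong (suc n) {appell-term y a n} {appell-term y b n}
            (λ l _ → ×-congʳ (n C l) (*-congˡ (a≈b l)))

  appell-+ : ∀ y a b n → appell y (λ l → a l + b l) n ≈ appell y a n + appell y b n
  appell-+ y a b n =
    trans (∑<-cong (suc n) {appell-term y (λ l → a l + b l) n} (λ l _ → distribute l))
          (∑<-+ (suc n) (appell-term y a n) (appell-term y b n))
    where
    distribute : ∀ l → (n C l) × (pow y (n ∸ l) * (a l + b l)) ≈
                       (n C l) × (pow y (n ∸ l) * a l) + (n C l) × (pow y (n ∸ l) * b l)
    distribute l = trans (×-congʳ (n C l) (distribˡ _ _ _)) (×-distrib-+ _ _ (n C l))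

  appell-* : ∀ y x a n → appell y (λ l → x * a l) n ≈ x * appell y a n
  appell-* y x a n =
    trans (∑<-cong (suc n) {appell-term y (λ l → x * a l) n} (λ l _ → pull-x l))
          (sym (*-distribˡ-∑< (suc n) x (appell-term y a n)))
    where
    pull-x : ∀ l → (n C l) × (pow y (n ∸ l) * (x * a l)) ≈ x * ((n C l) × (pow y (n ∸ l) * a l))
    pull-x l = trans (×-congʳ (n C l) (x*yz≈y*xz _ _ _)) (sym (×-comm-* (n C l) x _))

  appell-1#-point : ∀ a → (∀ l → a (suc l) ≈ 0#) → ∀ n → appell 1# a n ≈ a 0
  appell-1#-point a a₊≈0 n = begin
    1 × (pow 1# n * a 0) + ∑< n (λ l → (n C suc l) × (pow 1# (n ∸ suc l) * a (suc l)))
      ≈⟨ +-cong (×-homo-1 _) (∑<-cong n (λ l _ → vanish l)) ⟩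
    pow 1# n * a 0 + ∑< n (λ _ → 0#)  ≈⟨ +-cong (*-congʳ (pow-1# n)) (sum-replicate-zero n) ⟩
    1# * a 0 + 0#                    ≈⟨ +-identityʳ _ ⟩
    1# * a 0                         ≈⟨ *-identityˡ (a 0) ⟩
    a 0                              ∎
    where
    vanish : ∀ l → (n C suc l) × (pow 1# (n ∸ suc l) * a (suc l)) ≈ 0#
    vanish l = begin
      (n C suc l) × (pow 1# (n ∸ suc l) * a (suc l)) ≈⟨ ×-congʳ (n C suc l) (*-congˡ (a₊≈0 l)) ⟩
      (n C suc l) × (pow 1# (n ∸ suc l) * 0#)        ≈⟨ ×-congʳ (n C suc l) (zeroʳ _) ⟩
      (n C suc l) × 0#                               ≈⟨ sum-replicate (n C suc l) ⟨
      sum (replicate (n C suc l) 0#)                 ≈⟨ sum-replicate-zero (n C suc l) ⟩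
      0#                                             ∎

  appell-shift : ∀ x a n → appell 1# (appell x a) n ≈ appell (1# + x) a n
  appell-shift x a zero    = appell-zero 1# (appell x a)
  appell-shift x a (suc n) = begin
    appell 1# (appell x a) (suc n)
      ≈⟨ appell-suc 1# (appell x a) n ⟩
    1# * appell 1# (appell x a) n + appell 1# (λ k → appell x a (suc k)) n
      ≈⟨ +-cong (*-identityˡ _) (appell-cong 1# (λ k → appell-suc x a k) n) ⟩
    appell 1# (appell x a) n + appell 1# (λ k → x * appell x a k + appell x a₊ k) n
      ≈⟨ +-congˡ (trans (appell-+ 1# (λ k → x * appell x a k) (appell x a₊) n)
                         (+-congʳ (appell-* 1# x (appell x a) n))) ⟩
    appell 1# (appell x a) n + (x * appell 1# (appell x a) n + appell 1# (appell x a₊) n)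
      ≈⟨ +-cong (appell-shift x a n) (+-cong (*-congˡ (appell-shift x a n)) (appell-shift x a₊ n)) ⟩
    T + (x * T + T₊)                                               ≈⟨ +-assoc _ _ _ ⟨
    (T + x * T) + T₊                                               ≈⟨ +-congʳ collect ⟩
    (1# + x) * T + T₊                                              ≈⟨ appell-suc (1# + x) a n ⟨
    appell (1# + x) a (suc n)                                      ∎
    where
    a₊ : ℕ → Carrier
    a₊ l = a (suc l)
    T T₊ : Carrier
    T  = appell (1# + x) a n
    T₊ = appell (1# + x) a₊ n
    collect : T + x * T ≈ (1# + x) * T
    collect = sym (trans (distribʳ T 1# x) (+-congʳ (*-identityˡ T)))

  solves-recurrence : ∀ {q u d s e} → (q + 1#) * u ≈ 1# → e ≈ u * (d - q * s) →
                      q * (s + e) + e ≈ d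
  solves-recurrence {q} {u} {d} {s} {e} hu e≈ = begin
    q * (s + e) + e                      ≈⟨ +-congʳ (distribˡ q s e) ⟩
    (q * s + q * e) + e                  ≈⟨ +-assoc _ _ _ ⟩
    q * s + (q * e + e)                  ≈⟨ +-congˡ (+-congˡ (*-identityˡ e)) ⟨
    q * s + (q * e + 1# * e)             ≈⟨ +-congˡ (distribʳ e q 1#) ⟨
    q * s + (q + 1#) * e                 ≈⟨ +-congˡ (*-congˡ e≈) ⟩
    q * s + (q + 1#) * (u * (d - q * s)) ≈⟨ +-congˡ (*-assoc _ _ _) ⟨
    q * s + ((q + 1#) * u) * (d - q * s) ≈⟨ +-congˡ (trans (*-congʳ hu) (*-identityˡ _)) ⟩
    q * s + (d - q * s)                  ≈⟨ x∙yz≈y∙xz _ _ _ ⟩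
    d + (q * s - q * s)                  ≈⟨ +-congˡ (-‿inverseʳ _) ⟩
    d + 0#                               ≈⟨ +-identityʳ d ⟩
    d                                    ∎

  eliminate : ∀ {x y z a} → x + y ≈ a → y + z ≈ 0# → x ≈ a + z
  eliminate {x} {y} {z} {a} x+y≈a y+z≈0 = begin
    x             ≈⟨ +-identityʳ x ⟨
    x + 0#        ≈⟨ +-congˡ y+z≈0 ⟨
    x + (y + z)   ≈⟨ +-assoc x y z ⟨
    (x + y) + z   ≈⟨ +-congʳ x+y≈a ⟩
    a + z         ∎

  module QEuler (q u : Carrier) (hu : (q + 1#) * u ≈ 1#) where

    E : ℕ → Carrier
    E = Eul q u

    table-lookup : ∀ m (i : Fin m) → lookup (table q u m) i ≡ E (toℕ i)
    table-lookup (suc m) i with last-or-inject₁ i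
    ... | inj₁ ≡.refl       = ≡.cong E (≡.sym (toℕ-fromℕ m))
    ... | inj₂ (j , ≡.refl) = ≡.trans (lookup-∷ʳ-inject₁ (table q u m) _ j)
                                (≡.trans (table-lookup m j) (≡.cong E (≡.sym (toℕ-inject₁ j))))

    table-sum : ∀ k → sumFin k (λ i → (k C toℕ i) · lookup (table q u k) i) ≡
                      ∑< k (λ l → (k C l) × E l)
    table-sum k = ≡.trans (sumFin-· k (λ i → k C toℕ i) (lookup (table q u k)))
                          (sum-cong-≗ (λ i → ≡.cong ((k C toℕ i) ×_) (table-lookup k i)))

    Eul-unfold : ∀ k → E k ≈ u * (δ₀ k - q * ∑< k (λ l → (k C l) × E l))
    Eul-unfold k = trans (reflexive (lookup-∷ʳ-last (table q u k) _))
                         (*-congˡ (+-congˡ (-‿cong (*-congˡ (reflexive (table-sum k))))))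

    Eul-rec : ∀ k → q * appell 1# E k + E k ≈ δ₀ k
    Eul-rec k = begin
      q * appell 1# E k + E k                      ≈⟨ +-congʳ (*-congˡ (appell-top 1# E k)) ⟩
      q * (∑< k (appell-term 1# E k) + E k) + E k
        ≈⟨ +-congʳ (*-congˡ (+-congʳ drop-powers)) ⟩
      q * (∑< k (λ l → (k C l) × E l) + E k) + E k ≈⟨ solves-recurrence hu (Eul-unfold k) ⟩
      δ₀ k                                         ∎
      where
      drop-powers : ∑< k (appell-term 1# E k) ≈ ∑< k (λ l → (k C l) × E l)
      drop-powers = ∑<-cong k {appell-term 1# E k} (λ l _ →
        ×-congʳ (k C l) (trans (*-congʳ (pow-1# (k ∸ l))) (*-identityˡ (E l))))

    EulPoly≡appell : ∀ n y → EulPoly q u n y ≡ appell y E n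
    EulPoly≡appell n y = sumFin-· (suc n) (λ i → n C toℕ i) (λ i → pow y (n ∸ toℕ i) * E (toℕ i))

    Eul-at-1 : ∀ q⁻¹ → q * q⁻¹ ≈ 1# → ∀ n → 1 ≤ n → appell 1# E n + q⁻¹ * E n ≈ 0#
    Eul-at-1 q⁻¹ hq (suc m) _ = begin
      F + q⁻¹ * e                 ≈⟨ +-congʳ (*-identityˡ F) ⟨
      1# * F + q⁻¹ * e            ≈⟨ +-congʳ (*-congʳ (trans (*-comm q⁻¹ q) hq)) ⟨
      (q⁻¹ * q) * F + q⁻¹ * e     ≈⟨ +-congʳ (*-assoc _ _ _) ⟩
      q⁻¹ * (q * F) + q⁻¹ * e     ≈⟨ distribˡ _ _ _ ⟨
      q⁻¹ * (q * F + e)           ≈⟨ *-congˡ (Eul-rec (suc m)) ⟩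
      q⁻¹ * 0#                    ≈⟨ zeroʳ _ ⟩
      0#                          ∎
      where
      F e : Carrier
      F = appell 1# E (suc m)
      e = E (suc m)

    -- q E_n(2) + E_n(1) = 2: the binomial transform of the recurrence.
    Eul-at-2 : ∀ n → q * appell two E n + appell 1# E n ≈ two
    Eul-at-2 n = begin
      q * appell two E n + appell 1# E n
        ≈⟨ +-congʳ (*-congˡ (appell-shift 1# E n)) ⟨
      q * appell 1# F n + appell 1# E n
        ≈⟨ trans (appell-+ 1# (λ k → q * F k) E n) (+-congʳ (appell-* 1# q F n)) ⟨
      appell 1# (λ k → q * F k + E k) n   ≈⟨ appell-cong 1# Eul-rec n ⟩
      appell 1# δ₀ n                      ≈⟨ appell-1#-point δ₀ (λ _ → refl) n ⟩
      two                                 ∎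
      where
      F : ℕ → Carrier
      F = appell 1# E

theorem2 : {c ℓ : Level} (R : CommutativeRing c ℓ) →
    let open CommutativeRing R
        open EulerDefs R
    in (q q⁻¹ u : Carrier) → q * q⁻¹ ≈ 1# → (q + 1#) * u ≈ 1# →
       (n : ℕ) → 1 ≤ n →
       q * EulPoly q u n two ≈ two + q⁻¹ * Eul q u n
theorem2 R q q⁻¹ u hq hu n 1≤n =
  trans (*-congˡ (reflexive (EulPoly≡appell n two)))
        (eliminate (Eul-at-2 n) (Eul-at-1 q⁻¹ hq n 1≤n))
  where
  open CommutativeRing R
  open EulerDefs R
  open AppellPolynomials R
  open QEuler q u hu
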